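{- Let $G=(V,E)$ be a finite graph (loops and multiple edges allowed) and let $A,B\subseteq V^2$. Then the number of $(A,B)$-valid orientations of $G$ equals the number of $(A,B)$-valid subgraphs of $G$.
   Context: For an orientation $\alpha$ of $G$, let $\vec G(A,B;\alpha)$ be the digraph obtained from $\alpha$ by adding an arc from $u$ to $v$ for each $(u,v)\in A$ and for each $(u,v)\in B$. For a subgraph $H=(V,F)$ with $F\subseteq E$, let $\vec G(A,B;F)$ be the digraph obtained from $H$ by replacing every edge of $F$ by two arcs in opposite directions and adding an arc from $u$ to $v$ for each $(u,v)\in A$ and each $(u,v)\in B$. The orientation $\alpha$ (resp. subgraph $H$) is $(A,B)$-valid if the corresponding digraph satisfies: (a) for every $(u,v)\in A$, there is no directed path from $v$ to $u$; (b) for every $(u,v)\in B$, there is a directed path from $v$ to $u$. Subgraphs are counted as subsets $F\subseteq E$. -}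

module Defs where

open import Level using (Level)
open import Data.Nat using (ℕ; zero; suc)
open import Data.Fin using (Fin; zero; suc)
open import Data.Bool using (Bool; true; false)
open import Data.Product using (Σ; _×_; _,_; ∃)
open import Data.Sum using (_⊎_)
open import Data.List using (List; []; _∷_; _++_; map; length; filter)
open import Data.List.Membership.Propositional using (_∈_)
open import Relation.Binary.PropositionalEquality using (_≡_)
open import Relation.Binary.Construct.Closure.ReflexiveTransitive using (Star)
open import Relation.Nullary using (¬_)
open import Relation.Unary using (Pred; Decidable)

-- A finite multigraph (loops and parallel edges allowed):
-- vertex set Fin n, edge set Fin m, each edge with an (ordered, but
-- only used as unordered) pair of endpoints.
record Graph : Set where
  field
    n    : ℕ
    m    : ℕ
    ends : Fin m → Fin n × Fin n

open Graph public

Vtx : Graph → Set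
Vtx G = Fin (n G)

Pairs : Graph → Set
Pairs G = List (Vtx G × Vtx G)

-- An orientation: for each edge e with ends (x , y), true means x → y,
-- false means y → x.
Orientation : Graph → Set
Orientation G = Fin (m G) → Bool

-- A spanning subgraph (V , F): F ⊆ E given by its indicator.
Subgraph : Graph → Set
Subgraph G = Fin (m G) → Bool

ExtraArc : (G : Graph) → Pairs G → Pairs G → Vtx G → Vtx G → Set
ExtraArc G A B u v = ((u , v) ∈ A) ⊎ ((u , v) ∈ B)

OArc : (G : Graph) → Pairs G → Pairs G → Orientation G → Vtx G → Vtx G → Set
OArc G A B α u v =
  (Σ (Fin (m G)) λ e → (α e ≡ true × ends G e ≡ (u , v)) ⊎ (α e ≡ false × ends G e ≡ (v , u)))
  ⊎ ExtraArc G A B u v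

SArc : (G : Graph) → Pairs G → Pairs G → Subgraph G → Vtx G → Vtx G → Set
SArc G A B F u v =
  (Σ (Fin (m G)) λ e → F e ≡ true × (ends G e ≡ (u , v) ⊎ ends G e ≡ (v , u)))
  ⊎ ExtraArc G A B u v

Valid : (G : Graph) → Pairs G → Pairs G → (Vtx G → Vtx G → Set) → Set
Valid G A B R =
  (∀ {u v} → (u , v) ∈ A → ¬ Star R v u) ×
  (∀ {u v} → (u , v) ∈ B → Star R v u)

OValid : (G : Graph) → Pairs G → Pairs G → Orientation G → Set
OValid G A B α = Valid G A B (OArc G A B α)

SValid : (G : Graph) → Pairs G → Pairs G → Subgraph G → Set
SValid G A B F = Valid G A B (SArc G A B F)

-- All functions Fin k → Bool, each exactly once.
allBoolFuns : (k : ℕ) → List (Fin k → Bool)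
allBoolFuns zero = (λ ()) ∷ []
allBoolFuns (suc k) =
  map (λ f → λ { zero → true ; (suc i) → f i }) (allBoolFuns k) ++
  map (λ f → λ { zero → false ; (suc i) → f i }) (allBoolFuns k)

-- Number of f : Fin k → Bool satisfying a decidable predicate P.
-- (Independent of the chosen decision procedure.)
countBoolFuns : (k : ℕ) {ℓ : Level} {P : Pred (Fin k → Bool) ℓ} → Decidable P → ℕ
countBoolFuns k d = length (filter d (allBoolFuns k))

module Submission where

-- Induct on the edges, generalising the extra arcs A ∪ B to any arc set X ⊇ A ∪ B. An
-- orientation turns the first edge xy into the extra arc x → y or y → x, a subgraph either
-- into both arcs or into nothing. So it suffices that for every digraph R ⊇ A ∪ B
--   [R + xy valid] + [R + yx valid] = [R + xy + yx valid] + [R valid].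
-- Validity only depends on whether v ⇝ u for the constraint arcs u → v. If y ⇝ x in R,
-- the arc y → x changes no reachability, and symmetrically if x ⇝ y. If neither, a new
-- path v ⇝ u through an added arc would, together with u → v, give x ⇝ y or y ⇝ x in R;
-- so all four digraphs are valid or invalid together.

open import Algebra.Properties.CommutativeSemigroup using (interchange)
open import Data.Bool using (Bool; true; false; if_then_else_) renaming (_≟_ to _≟ᵇ_)
open import Data.Bool.Properties using (not-¬)
open import Data.Empty using (⊥-elim)
open import Data.Fin using (Fin; zero; suc; _≟_)
open import Data.Fin.Properties using (any?)
open import Data.List using (List; []; _∷_; _++_; map; length; filter; allFin)
import Data.List.Membership.DecPropositional as DecMembership
open import Data.List.Membership.Propositional using (_∈_)
open import Data.List.Membership.Propositional.Properties using (∈-filter⁺; ∈-filter⁻; ∈-allFin)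
open import Data.List.Properties using (filter-++; filter-≐; filter-notAll; length-++)
import Data.List.Relation.Unary.All as All
import Data.List.Relation.Unary.Any as Any
open import Data.Nat using (ℕ; zero; suc; _+_; _≤_; _<_)
open import Data.Nat.Properties using (+-comm; +-commutativeSemigroup; ≤-refl; ≤-trans; ≤-pred)
open import Data.Product using (Σ; ∃; _×_; _,_; proj₁; proj₂; swap)
open import Data.Product.Properties using (≡-dec)
open import Data.Sum using (_⊎_; inj₁; inj₂; map₁; assocˡ; assocʳ)
open import Function using (_∘_; id)
open import Function.Bundles using (_⇔_; mk⇔; module Equivalence)
open import Function.Construct.Symmetry using (⇔-sym)
open import Level using (0ℓ)
open import Relation.Binary.Core using (Rel; _⇒_) renaming (_⇔_ to _⇔₂_)
open import Relation.Binary.Definitions using () renaming (Decidable to Decidable₂)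
open import Relation.Binary.Construct.Closure.ReflexiveTransitive
  using (Star; ε; _◅_; _◅◅_; return; _⋆)
import Relation.Binary.Construct.Closure.ReflexiveTransitive as Star
open import Relation.Binary.PropositionalEquality
  using (_≡_; refl; sym; trans; cong; cong₂; module ≡-Reasoning)
open import Relation.Nullary using (Dec; yes; no; ¬_; ¬?; does)
open import Relation.Nullary.Decidable using (_×-dec_; _⊎-dec_; does-⇔; map′)
import Relation.Nullary.Decidable as Dec
open import Relation.Unary using (Pred; Decidable; _≐_)

open import Defs

indicator : ∀ {p} {P : Set p} → Dec P → ℕ
indicator d = if does d then 1 else 0

indicator-⇔ : ∀ {p q} {P : Set p} {Q : Set q} → P ⇔ Q →
              (d : Dec P) (e : Dec Q) → indicator d ≡ indicator e
indicator-⇔ P⇔Q d e = cong (λ b → if b then 1 else 0) (does-⇔ P⇔Q d e)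

count : ∀ {a p} {X : Set a} {P : Pred X p} → Decidable P → List X → ℕ
count d xs = length (filter d xs)

module _ {a p} {X : Set a} {P : Pred X p} (d : Decidable P) where

  count-∷ : ∀ x xs → count d (x ∷ xs) ≡ indicator (d x) + count d xs
  count-∷ x xs with does (d x)
  ... | true  = refl
  ... | false = refl

  count-++ : ∀ xs ys → count d (xs ++ ys) ≡ count d xs + count d ys
  count-++ xs ys = trans (cong length (filter-++ d xs ys)) (length-++ (filter d xs))

  count-map : ∀ {b} {Y : Set b} (g : Y → X) ys → count d (map g ys) ≡ count (d ∘ g) ys
  count-map g []       = refl
  count-map g (y ∷ ys) with does (d (g y))
  ... | true  = cong suc (count-map g ys)
  ... | false = count-map g ys

count-≐ : ∀ {a p q} {X : Set a} {P : Pred X p} {Q : Pred X q} (d : Decidable P) (e : Decidable Q) →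
          P ≐ Q → ∀ xs → count d xs ≡ count e xs
count-≐ d e P≐Q xs = cong length (filter-≐ d e P≐Q xs)

count-interchange :
  ∀ {a p} {X : Set a} {P₀ P₁ P₂ P₃ : Pred X p}
  (d₀ : Decidable P₀) (d₁ : Decidable P₁) (d₂ : Decidable P₂) (d₃ : Decidable P₃) →
  (∀ x → indicator (d₁ x) + indicator (d₂ x) ≡ indicator (d₃ x) + indicator (d₀ x)) →
  ∀ xs → count d₁ xs + count d₂ xs ≡ count d₃ xs + count d₀ xs
count-interchange d₀ d₁ d₂ d₃ pointwise []       = refl
count-interchange d₀ d₁ d₂ d₃ pointwise (x ∷ xs) = begin
  count d₁ (x ∷ xs) + count d₂ (x ∷ xs)
    ≡⟨ cong₂ _+_ (count-∷ d₁ x xs) (count-∷ d₂ x xs) ⟩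
  (indicator (d₁ x) + count d₁ xs) + (indicator (d₂ x) + count d₂ xs)
    ≡⟨ interchange +-commutativeSemigroup (indicator (d₁ x)) _ _ _ ⟩
  (indicator (d₁ x) + indicator (d₂ x)) + (count d₁ xs + count d₂ xs)
    ≡⟨ cong₂ _+_ (pointwise x) (count-interchange d₀ d₁ d₂ d₃ pointwise xs) ⟩
  (indicator (d₃ x) + indicator (d₀ x)) + (count d₃ xs + count d₀ xs)
    ≡⟨ interchange +-commutativeSemigroup (indicator (d₃ x)) _ _ _ ⟩
  (indicator (d₃ x) + count d₃ xs) + (indicator (d₀ x) + count d₀ xs)
    ≡⟨ cong₂ _+_ (count-∷ d₃ x xs) (count-∷ d₀ x xs) ⟨
  count d₃ (x ∷ xs) + count d₀ (x ∷ xs) ∎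
  where open ≡-Reasoning

countBoolFuns-irrelevant : ∀ {k p} {P : Pred (Fin k → Bool) p} (d e : Decidable P) →
                           countBoolFuns k d ≡ countBoolFuns k e
countBoolFuns-irrelevant {k} d e = count-≐ d e (id , id) (allBoolFuns k)

countBoolFuns-suc :
  ∀ {k p q r} {P : Pred (Fin (suc k) → Bool) p} {Q₁ : Pred (Fin k → Bool) q} {Q₀ : Pred (Fin k → Bool) r}
  (d : Decidable P) (d₁ : Decidable Q₁) (d₀ : Decidable Q₀) →
  (∀ {α} → α zero ≡ true → P α ⇔ Q₁ (α ∘ suc)) →
  (∀ {α} → α zero ≡ false → P α ⇔ Q₀ (α ∘ suc)) →
  countBoolFuns (suc k) d ≡ countBoolFuns k d₁ + countBoolFuns k d₀
countBoolFuns-suc {k} d d₁ d₀ first-true first-false =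
  trans (count-++ d (map _ fs) (map _ fs))
        (cong₂ _+_
          (trans (count-map d _ fs) (count-≐ _ d₁ (to (first-true refl) , from (first-true refl)) fs))
          (trans (count-map d _ fs) (count-≐ _ d₀ (to (first-false refl) , from (first-false refl)) fs)))
  where
  fs = allBoolFuns k
  open Equivalence

module Reachability {k} {R : Rel (Fin k) 0ℓ} (R? : Decidable₂ R) where

  open DecMembership (_≟_ {k}) using (_∈?_)

  Within : List (Fin k) → Rel (Fin k) 0ℓ
  Within L u w = R u w × w ∈ L

  without : Fin k → List (Fin k) → List (Fin k)
  without w = filter (λ x → ¬? (x ≟ w))

  without-⊆ : ∀ {w x L} → x ∈ without w L → x ∈ L
  without-⊆ = proj₁ ∘ ∈-filter⁻ (λ x → ¬? (x ≟ _))

  without-shorter : ∀ {w L} → w ∈ L → length (without w L) < length L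
  without-shorter {w} {L} w∈L =
    filter-notAll (λ x → ¬? (x ≟ w)) L (Any.map (λ w≡x x≢w → x≢w (sym w≡x)) w∈L)

  Star-Within-cut : ∀ {L} w {u v} → Star (Within L) u v →
                    Star (Within (without w L)) u v ⊎ Star (Within (without w L)) w v
  Star-Within-cut w ε = inj₁ ε
  Star-Within-cut w (_◅_ {j = x} (r , x∈L) p) with Star-Within-cut w p | x ≟ w
  ... | inj₂ q | _        = inj₂ q
  ... | inj₁ q | yes refl = inj₂ q
  ... | inj₁ q | no x≢w   = inj₁ ((r , ∈-filter⁺ (λ x → ¬? (x ≟ w)) x∈L x≢w) ◅ q)

  Star-Within-first-step : ∀ {L u v} → Star (Within L) u v → ¬ u ≡ v →
                           ∃ λ w → w ∈ L × R u w × Star (Within (without w L)) w v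
  Star-Within-first-step ε u≢v = ⊥-elim (u≢v refl)
  Star-Within-first-step (_◅_ {j = w} (r , w∈L) p) _ with Star-Within-cut w p
  ... | inj₁ q = w , w∈L , r , q
  ... | inj₂ q = w , w∈L , r , q

  -- fuel bounds length L, which drops at each step as the first successor leaves L.
  Star-Within? : ∀ fuel L → length L ≤ fuel → Decidable₂ (Star (Within L))
  Star-Within? fuel L _ u v with u ≟ v
  ... | yes refl = yes ε
  Star-Within? zero [] _ u v | no u≢v = no λ { ε → u≢v refl ; ((_ , ()) ◅ _) }
  Star-Within? (suc fuel) L L≤fuel u v | no u≢v =
    map′ (λ (w , w∈L , r , p) → (r , w∈L) ◅ Star.map (λ (r′ , x∈) → r′ , without-⊆ x∈) p)
         (λ p → Star-Within-first-step p u≢v)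
         (any? first-step?)
    where
    first-step? : ∀ w → Dec (w ∈ L × R u w × Star (Within (without w L)) w v)
    first-step? w with w ∈? L
    ... | no w∉L  = no (w∉L ∘ proj₁)
    ... | yes w∈L = map′ (w∈L ,_) proj₂
      (R? u w ×-dec Star-Within? fuel (without w L) (≤-pred (≤-trans (without-shorter w∈L) L≤fuel)) w v)

  Star? : Decidable₂ (Star R)
  Star? u v = map′ (Star.map proj₁) (Star.map (λ r → r , ∈-allFin _))
                   (Star-Within? _ (allFin k) ≤-refl u v)

_+arc_ : {V : Set} → Rel V 0ℓ → V × V → Rel V 0ℓ
(R +arc p) u v = R u v ⊎ (u , v) ≡ p

Star-+arc⁻ : ∀ {V} {R : Rel V 0ℓ} {a b u v} →
             Star (R +arc (a , b)) u v → Star R u v ⊎ (Star R u a × Star R b v)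
Star-+arc⁻ ε = inj₁ ε
Star-+arc⁻ (inj₁ r ◅ p) with Star-+arc⁻ p
... | inj₁ u⇝v         = inj₁ (r ◅ u⇝v)
... | inj₂ (u⇝a , b⇝v) = inj₂ (r ◅ u⇝a , b⇝v)
Star-+arc⁻ (inj₂ refl ◅ p) with Star-+arc⁻ p
... | inj₁ b⇝v       = inj₂ (ε , b⇝v)
... | inj₂ (_ , b⇝v) = inj₂ (ε , b⇝v)

module _ {V : Set} {R : Rel V 0ℓ} where

  Star-+arc-redundant : ∀ {a b} → Star R a b → Star (R +arc (a , b)) ⇒ Star R
  Star-+arc-redundant a⇝b = (λ { (inj₁ r) → return r ; (inj₂ refl) → a⇝b }) ⋆

  Star-+arc-mono : ∀ {S : Rel V 0ℓ} {p} → Star R ⇒ Star S → Star (R +arc p) ⇒ Star (S +arc p)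
  Star-+arc-mono R⇝S = (λ { (inj₁ r) → Star.map inj₁ (R⇝S (return r))
                         ; (inj₂ e) → return (inj₂ e) }) ⋆

  Star-+arc-reverse : ∀ {a b u v} → ¬ Star R b a → R u v → Star (R +arc (a , b)) v u → Star R v u
  Star-+arc-reverse b⇏a r p with Star-+arc⁻ p
  ... | inj₁ v⇝u         = v⇝u
  ... | inj₂ (v⇝a , b⇝u) = ⊥-elim (b⇏a (b⇝u ◅◅ r ◅ v⇝a))

  Star-+arc²-reverse : ∀ {a b u v} → ¬ Star R a b → ¬ Star R b a → R u v →
                       Star ((R +arc (a , b)) +arc (b , a)) v u → Star R v u
  Star-+arc²-reverse a⇏b b⇏a r p with Star-+arc⁻ p
  ... | inj₁ v⇝u = Star-+arc-reverse b⇏a r v⇝u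
  ... | inj₂ (v⇝b , a⇝u) with Star-+arc⁻ v⇝b | Star-+arc⁻ a⇝u
  ...   | inj₁ v⇝b       | inj₁ a⇝u       = ⊥-elim (a⇏b (a⇝u ◅◅ r ◅ v⇝b))
  ...   | inj₁ v⇝b       | inj₂ (_ , b⇝u) = v⇝b ◅◅ b⇝u
  ...   | inj₂ (v⇝a , _) | inj₁ a⇝u       = v⇝a ◅◅ a⇝u
  ...   | inj₂ (v⇝a , _) | inj₂ (_ , b⇝u) = ⊥-elim (b⇏a (b⇝u ◅◅ r ◅ v⇝a))

module Validity (G : Graph) (A B : Pairs G) where

  private
    V = Vtx G
    open Equivalence

  Valid-cong : {R S : Rel V 0ℓ} → (∀ {u v} → ExtraArc G A B u v → Star R v u ⇔ Star S v u) →
               Valid G A B R ⇔ Valid G A B S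
  Valid-cong eq =
    mk⇔ (λ (noPath , path) → (λ uv∈A → noPath uv∈A ∘ from (eq (inj₁ uv∈A)))
                           , (λ uv∈B → to (eq (inj₂ uv∈B)) (path uv∈B)))
        (λ (noPath , path) → (λ uv∈A → noPath uv∈A ∘ to (eq (inj₁ uv∈A)))
                           , (λ uv∈B → from (eq (inj₂ uv∈B)) (path uv∈B)))

  Valid-⇔₂ : {R S : Rel V 0ℓ} → R ⇔₂ S → Valid G A B R ⇔ Valid G A B S
  Valid-⇔₂ (R⇒S , S⇒R) = Valid-cong λ _ → mk⇔ (Star.map R⇒S) (Star.map S⇒R)

  Valid? : {R : Rel V 0ℓ} → Decidable₂ (Star R) → Dec (Valid G A B R)
  Valid? Star? =
    map′ (λ (noPaths , paths) → All.lookup noPaths , All.lookup paths)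
         (λ (noPath , path) → All.tabulate noPath , All.tabulate path)
         (All.all? (λ (u , v) → ¬? (Star? v u)) A ×-dec All.all? (λ (u , v) → Star? v u) B)

  Valid-+arc-reachable : ∀ {R : Rel V 0ℓ} {a b} → Star R a b →
                         Valid G A B (R +arc (a , b)) ⇔ Valid G A B R
  Valid-+arc-reachable a⇝b = Valid-cong λ _ → mk⇔ (Star-+arc-redundant a⇝b) (Star.map inj₁)

  module _ {R : Rel V 0ℓ} (R⊇AB : ExtraArc G A B ⇒ R) where

    Valid-+arc-unreachable : ∀ {a b} → ¬ Star R b a → Valid G A B (R +arc (a , b)) ⇔ Valid G A B R
    Valid-+arc-unreachable b⇏a = Valid-cong λ uv → mk⇔ (Star-+arc-reverse b⇏a (R⊇AB uv)) (Star.map inj₁)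

    Valid-+arc²-unreachable : ∀ {a b} → ¬ Star R a b → ¬ Star R b a →
                              Valid G A B ((R +arc (a , b)) +arc (b , a)) ⇔ Valid G A B R
    Valid-+arc²-unreachable a⇏b b⇏a =
      Valid-cong λ uv → mk⇔ (Star-+arc²-reverse a⇏b b⇏a (R⊇AB uv)) (Star.map (inj₁ ∘ inj₁))

    indicator-+arc-identity :
      ∀ a b → Dec (Star R a b) → Dec (Star R b a) →
      (d₀ : Dec (Valid G A B R)) (d₁ : Dec (Valid G A B (R +arc (a , b))))
      (d₂ : Dec (Valid G A B (R +arc (b , a)))) (d₃ : Dec (Valid G A B ((R +arc (a , b)) +arc (b , a)))) →
      indicator d₁ + indicator d₂ ≡ indicator d₃ + indicator d₀
    indicator-+arc-identity a b _ (yes b⇝a) d₀ d₁ d₂ d₃ =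
      cong₂ _+_ (indicator-⇔ (⇔-sym (Valid-+arc-reachable (Star.map inj₁ b⇝a))) d₁ d₃)
                (indicator-⇔ (Valid-+arc-reachable b⇝a) d₂ d₀)
    indicator-+arc-identity a b (yes a⇝b) (no _) d₀ d₁ d₂ d₃ =
      trans (cong₂ _+_ (indicator-⇔ (Valid-+arc-reachable a⇝b) d₁ d₀)
                       (indicator-⇔ (⇔-sym ab+ba⇔ba) d₂ d₃))
            (+-comm (indicator d₀) (indicator d₃))
      where
      ab+ba⇔ba : Valid G A B ((R +arc (a , b)) +arc (b , a)) ⇔ Valid G A B (R +arc (b , a))
      ab+ba⇔ba = Valid-cong λ _ → mk⇔ (Star-+arc-mono (Star-+arc-redundant a⇝b))
                                      (Star-+arc-mono (Star.map inj₁))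
    indicator-+arc-identity a b (no a⇏b) (no b⇏a) d₀ d₁ d₂ d₃ = begin
      indicator d₁ + indicator d₂ ≡⟨ cong₂ _+_ (indicator-⇔ (Valid-+arc-unreachable b⇏a) d₁ d₀)
                                               (indicator-⇔ (Valid-+arc-unreachable a⇏b) d₂ d₀) ⟩
      indicator d₀ + indicator d₀ ≡⟨ cong (_+ indicator d₀)
                                          (indicator-⇔ (Valid-+arc²-unreachable a⇏b b⇏a) d₃ d₀) ⟨
      indicator d₃ + indicator d₀ ∎
      where open ≡-Reasoning

module _ {V : Set} where

  -- OArc G A B and SArc G A B are definitionally OArcs (ends G) (ExtraArc G A B) and
  -- SArcs (ends G) (ExtraArc G A B); the induction moves edges into the extra arcs X.
  OArcs : ∀ {k} → (Fin k → V × V) → Rel V 0ℓ → (Fin k → Bool) → Rel V 0ℓ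
  OArcs {k} en X α u v =
    (Σ (Fin k) λ e → (α e ≡ true × en e ≡ (u , v)) ⊎ (α e ≡ false × en e ≡ (v , u))) ⊎ X u v

  SArcs : ∀ {k} → (Fin k → V × V) → Rel V 0ℓ → (Fin k → Bool) → Rel V 0ℓ
  SArcs {k} en X F u v = (Σ (Fin k) λ e → F e ≡ true × (en e ≡ (u , v) ⊎ en e ≡ (v , u))) ⊎ X u v

  module _ {k} (en : Fin (suc k) → V × V) {X : Rel V 0ℓ} where

    OArcs-first-true : ∀ {α} → α zero ≡ true →
                       OArcs en X α ⇔₂ OArcs (en ∘ suc) (X +arc en zero) (α ∘ suc)
    OArcs-first-true {α} α₀ = to , from
      where
      to : OArcs en X α ⇒ OArcs (en ∘ suc) (X +arc en zero) (α ∘ suc)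
      to (inj₁ (zero , inj₁ (_ , eq)))  = inj₂ (inj₂ (sym eq))
      to (inj₁ (zero , inj₂ (α₀′ , _))) = ⊥-elim (not-¬ α₀ α₀′)
      to (inj₁ (suc e , arc))           = inj₁ (e , arc)
      to (inj₂ x)                       = inj₂ (inj₁ x)
      from : OArcs (en ∘ suc) (X +arc en zero) (α ∘ suc) ⇒ OArcs en X α
      from (inj₁ (e , arc))    = inj₁ (suc e , arc)
      from (inj₂ (inj₁ x))     = inj₂ x
      from (inj₂ (inj₂ eq))    = inj₁ (zero , inj₁ (α₀ , sym eq))

    OArcs-first-false : ∀ {α} → α zero ≡ false →
                        OArcs en X α ⇔₂ OArcs (en ∘ suc) (X +arc swap (en zero)) (α ∘ suc)
    OArcs-first-false {α} α₀ = to , from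
      where
      to : OArcs en X α ⇒ OArcs (en ∘ suc) (X +arc swap (en zero)) (α ∘ suc)
      to (inj₁ (zero , inj₁ (α₀′ , _))) = ⊥-elim (not-¬ α₀′ α₀)
      to (inj₁ (zero , inj₂ (_ , eq)))  = inj₂ (inj₂ (cong swap (sym eq)))
      to (inj₁ (suc e , arc))           = inj₁ (e , arc)
      to (inj₂ x)                       = inj₂ (inj₁ x)
      from : OArcs (en ∘ suc) (X +arc swap (en zero)) (α ∘ suc) ⇒ OArcs en X α
      from (inj₁ (e , arc))    = inj₁ (suc e , arc)
      from (inj₂ (inj₁ x))     = inj₂ x
      from (inj₂ (inj₂ eq))    = inj₁ (zero , inj₂ (α₀ , cong swap (sym eq)))

    SArcs-first-true : ∀ {F} → F zero ≡ true →
                       SArcs en X F ⇔₂ SArcs (en ∘ suc) ((X +arc en zero) +arc swap (en zero)) (F ∘ suc)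
    SArcs-first-true {F} F₀ = to , from
      where
      to : SArcs en X F ⇒ SArcs (en ∘ suc) ((X +arc en zero) +arc swap (en zero)) (F ∘ suc)
      to (inj₁ (zero , _ , inj₁ eq)) = inj₂ (inj₁ (inj₂ (sym eq)))
      to (inj₁ (zero , _ , inj₂ eq)) = inj₂ (inj₂ (cong swap (sym eq)))
      to (inj₁ (suc e , arc))        = inj₁ (e , arc)
      to (inj₂ x)                    = inj₂ (inj₁ (inj₁ x))
      from : SArcs (en ∘ suc) ((X +arc en zero) +arc swap (en zero)) (F ∘ suc) ⇒ SArcs en X F
      from (inj₁ (e , arc))         = inj₁ (suc e , arc)
      from (inj₂ (inj₁ (inj₁ x)))   = inj₂ x
      from (inj₂ (inj₁ (inj₂ eq)))  = inj₁ (zero , F₀ , inj₁ (sym eq))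
      from (inj₂ (inj₂ eq))         = inj₁ (zero , F₀ , inj₂ (cong swap (sym eq)))

    SArcs-first-false : ∀ {F} → F zero ≡ false → SArcs en X F ⇔₂ SArcs (en ∘ suc) X (F ∘ suc)
    SArcs-first-false {F} F₀ = to , from
      where
      to : SArcs en X F ⇒ SArcs (en ∘ suc) X (F ∘ suc)
      to (inj₁ (zero , F₀′ , _)) = ⊥-elim (not-¬ F₀′ F₀)
      to (inj₁ (suc e , arc))    = inj₁ (e , arc)
      to (inj₂ x)                = inj₂ x
      from : SArcs (en ∘ suc) X (F ∘ suc) ⇒ SArcs en X F
      from (inj₁ (e , arc)) = inj₁ (suc e , arc)
      from (inj₂ x)         = inj₂ x

  OArcs⇔SArcs-edgeless : (en : Fin 0 → V × V) {X : Rel V 0ℓ} {α F : Fin 0 → Bool} →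
                         OArcs en X α ⇔₂ SArcs en X F
  OArcs⇔SArcs-edgeless en = (λ { (inj₂ x) → inj₂ x }) , (λ { (inj₂ x) → inj₂ x })

  SArcs-+arc : ∀ {k} {en : Fin k → V × V} {X F p} → SArcs en (X +arc p) F ⇔₂ (SArcs en X F +arc p)
  SArcs-+arc = assocˡ , assocʳ

  +arc-cong : ∀ {R S : Rel V 0ℓ} {p} → R ⇔₂ S → (R +arc p) ⇔₂ (S +arc p)
  +arc-cong (R⇒S , S⇒R) = map₁ R⇒S , map₁ S⇒R

module _ {n : ℕ} where

  private
    V = Fin n
    _≟ₚ_ = ≡-dec (_≟_ {n}) (_≟_ {n})

  +arc? : ∀ {R : Rel V 0ℓ} {p} → Decidable₂ R → Decidable₂ (R +arc p)
  +arc? {p = p} R? u v = R? u v ⊎-dec ((u , v) ≟ₚ p)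

  OArcs? : ∀ {k} (en : Fin k → V × V) {X} → Decidable₂ X → ∀ α → Decidable₂ (OArcs en X α)
  OArcs? en X? α u v =
    any? (λ e → ((α e ≟ᵇ true) ×-dec (en e ≟ₚ (u , v))) ⊎-dec ((α e ≟ᵇ false) ×-dec (en e ≟ₚ (v , u))))
      ⊎-dec X? u v

  SArcs? : ∀ {k} (en : Fin k → V × V) {X} → Decidable₂ X → ∀ F → Decidable₂ (SArcs en X F)
  SArcs? en X? F u v =
    any? (λ e → (F e ≟ᵇ true) ×-dec ((en e ≟ₚ (u , v)) ⊎-dec (en e ≟ₚ (v , u))))
      ⊎-dec X? u v

module Counting (G : Graph) (A B : Pairs G) where

  open Validity G A B

  private
    V = Vtx G

  ExtraArc? : Decidable₂ (ExtraArc G A B)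
  ExtraArc? u v = ((u , v) ∈? A) ⊎-dec ((u , v) ∈? B)
    where open DecMembership (≡-dec (_≟_ {n G}) (_≟_ {n G})) using (_∈?_)

  OValid? : ∀ {k} (en : Fin k → V × V) {X} → Decidable₂ X → Decidable (λ α → Valid G A B (OArcs en X α))
  OValid? en X? α = Valid? (Reachability.Star? (OArcs? en X? α))

  SValid? : ∀ {k} (en : Fin k → V × V) {X} → Decidable₂ X → Decidable (λ F → Valid G A B (SArcs en X F))
  SValid? en X? F = Valid? (Reachability.Star? (SArcs? en X? F))

  count-OValid≡count-SValid : ∀ k (en : Fin k → V × V) {X} (X? : Decidable₂ X) → ExtraArc G A B ⇒ X →
                              countBoolFuns k (OValid? en X?) ≡ countBoolFuns k (SValid? en X?)
  count-OValid≡count-SValid zero en X? _ = count-≐ (OValid? en X?) (SValid? en X?) O≐S (allBoolFuns 0)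
    where
    open Equivalence
    O≐S : (λ α → Valid G A B (OArcs en _ α)) ≐ (λ α → Valid G A B (SArcs en _ α))
    O≐S = (λ {α} → to (Valid-⇔₂ (OArcs⇔SArcs-edgeless en {α = α} {α})))
        , (λ {α} → from (Valid-⇔₂ (OArcs⇔SArcs-edgeless en {α = α} {α})))
  count-OValid≡count-SValid (suc k) en {X} X? X⊇AB = begin
    countBoolFuns (suc k) (OValid? en X?)
      ≡⟨ countBoolFuns-suc _ (OValid? en′ X+e?) (OValid? en′ X+ē?)
           (Valid-⇔₂ ∘ OArcs-first-true en) (Valid-⇔₂ ∘ OArcs-first-false en) ⟩
    #O X+e? + #O X+ē?
      ≡⟨ cong₂ _+_ (count-OValid≡count-SValid k en′ X+e? (inj₁ ∘ X⊇AB))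
                   (count-OValid≡count-SValid k en′ X+ē? (inj₁ ∘ X⊇AB)) ⟩
    #S X+e? + #S X+ē?
      ≡⟨ count-interchange (SValid? en′ X?) (SValid? en′ X+e?) (SValid? en′ X+ē?) (SValid? en′ X+e+ē?)
           pointwise (allBoolFuns k) ⟩
    #S X+e+ē? + #S X?
      ≡⟨ countBoolFuns-suc _ (SValid? en′ X+e+ē?) (SValid? en′ X?)
           (Valid-⇔₂ ∘ SArcs-first-true en) (Valid-⇔₂ ∘ SArcs-first-false en) ⟨
    countBoolFuns (suc k) (SValid? en X?) ∎
    where
    open ≡-Reasoning
    en′ = en ∘ suc
    e = en zero

    X+e? : Decidable₂ (X +arc e)
    X+e? = +arc? X?
    X+ē? : Decidable₂ (X +arc swap e)
    X+ē? = +arc? X?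
    X+e+ē? : Decidable₂ ((X +arc e) +arc swap e)
    X+e+ē? = +arc? X+e?

    #O #S : ∀ {Y} → Decidable₂ Y → ℕ
    #O Y? = countBoolFuns k (OValid? en′ Y?)
    #S Y? = countBoolFuns k (SValid? en′ Y?)

    pointwise : ∀ F → indicator (SValid? en′ X+e? F) + indicator (SValid? en′ X+ē? F)
                    ≡ indicator (SValid? en′ X+e+ē? F) + indicator (SValid? en′ X? F)
    pointwise F =
      indicator-+arc-identity (inj₂ ∘ X⊇AB) (proj₁ e) (proj₂ e) (Star? _ _) (Star? _ _)
        (SValid? en′ X? F)
        (Dec.map (Valid-⇔₂ SArcs-+arc) (SValid? en′ X+e? F))
        (Dec.map (Valid-⇔₂ SArcs-+arc) (SValid? en′ X+ē? F))
        (Dec.map (Valid-⇔₂ (+arc-cong SArcs-+arc))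
                 (Dec.map (Valid-⇔₂ SArcs-+arc) (SValid? en′ X+e+ē? F)))
      where open Reachability (SArcs? en′ X? F) using (Star?)

corollary3p2 : (G : Graph) (A B : Pairs G)
    (dO : Decidable (OValid G A B)) (dS : Decidable (SValid G A B)) →
    countBoolFuns (m G) dO ≡ countBoolFuns (m G) dS
corollary3p2 G A B dO dS = begin
  countBoolFuns (m G) dO                            ≡⟨ countBoolFuns-irrelevant dO (OValid? (ends G) ExtraArc?) ⟩
  countBoolFuns (m G) (OValid? (ends G) ExtraArc?)  ≡⟨ count-OValid≡count-SValid (m G) (ends G) ExtraArc? id ⟩
  countBoolFuns (m G) (SValid? (ends G) ExtraArc?)  ≡⟨ countBoolFuns-irrelevant (SValid? (ends G) ExtraArc?) dS ⟩
  countBoolFuns (m G) dS                            ∎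
  where
  open ≡-Reasoning
  open Counting G A B
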